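{- Let $n,k$ be positive integers with $k\geq 4$ and $n\geq 3k+1$. Then $$\left\lfloor\frac{(n+k-1)^2}{4}\right\rfloor\leq ex_{ori}(n,\overrightarrow{S_{k,1}})\leq \left\lfloor\frac{(n+k-1)^2}{4}\right\rfloor+(k-1)n.$$
   Context: An oriented graph is a digraph obtained from a finite simple undirected graph by choosing an orientation for each edge (so no loops, and at most one arc between any two vertices). For a digraph $F$, $D$ is $F$-free if it contains no subgraph isomorphic to $F$. The oriented Turán number $ex_{ori}(n,F)$ is the maximum number of arcs in an $F$-free oriented graph on $n$ vertices. For a positive integer $k$, $\overrightarrow{S_{k,1}}$ is the $1$-subdivision of the in-star with $k$ leaves: it has vertices $v$ (the center), $w_1,\dots,w_k$, $z_1,\dots,z_k$, and arcs $z_iw_i$ and $w_iv$ for $i=1,\dots,k$. -}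

module Defs where

open import Data.Nat using (ℕ; _+_; _*_; _∸_)
open import Data.Bool using (Bool; true; false; if_then_else_)
open import Data.Fin using (Fin)
open import Data.List using (map; allFin)
open import Data.Nat.ListAction using (sum)
open import Data.Product using (Σ; _×_)
open import Relation.Binary.PropositionalEquality using (_≡_; _≢_)
open import Relation.Nullary using (¬_)

-- A digraph on vertex set Fin n, given by its (decidable) arc relation:
-- A x y ≡ true  means there is an arc x → y.
Digraph : ℕ → Set
Digraph n = Fin n → Fin n → Bool

IsOriented : {n : ℕ} → Digraph n → Set
IsOriented {n} A =
  ((x : Fin n) → A x x ≡ false) ×
  ((x y : Fin n) → ¬ ((A x y ≡ true) × (A y x ≡ true)))

arcCount : {n : ℕ} → Digraph n → ℕ
arcCount {n} A =
  sum (map (λ x → sum (map (λ y → if A x y then 1 else 0) (allFin n))) (allFin n))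

-- A subgraph of A isomorphic to S_{k,1}: an injective choice of the
-- 2k+1 vertices v (center), w_1..w_k, z_1..z_k such that the arcs
-- z_i → w_i and w_i → v are all present in A.
record CopyOfS {n : ℕ} (k : ℕ) (A : Digraph n) : Set where
  field
    v : Fin n
    w : Fin k → Fin n
    z : Fin k → Fin n
    w-inj : (i j : Fin k) → w i ≡ w j → i ≡ j
    z-inj : (i j : Fin k) → z i ≡ z j → i ≡ j
    w≢z   : (i j : Fin k) → w i ≢ z j
    v≢w   : (i : Fin k) → v ≢ w i
    v≢z   : (i : Fin k) → v ≢ z i
    arc-zw : (i : Fin k) → A (z i) (w i) ≡ true
    arc-wv : (i : Fin k) → A (w i) v ≡ true

SFree : {n : ℕ} → ℕ → Digraph n → Set
SFree k A = ¬ CopyOfS k A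

{-# OPTIONS --safe #-}
module Submission where

-- Write K = k − 1.
--
-- Upper bound: call a vertex high if its in-degree is at least 2K + 1. No vertex v has K + 1
-- high in-neighbours w₀ … w_K: each w_i has at most K in-neighbours among the w_j, hence at
-- least K + 1 outside them, so distinct z_i → w_i can be chosen greedily, and v, w, z form a
-- copy of S_{K+1,1}. With h high and l low vertices, a high vertex thus has in-degree at most
-- K + l and a low one at most 2K, so the number of arcs is at most
-- hK + hl + 2lK = Kn + l(h + K) ≤ Kn + ⌊(n + K)²/4⌋ by AM-GM.
--
-- Lower bound: take b = ⌊(n + K)/2⌋, a = n − b, the circulant on ℤ/b in which p → q iff
-- p − q ∈ {1, …, K} (oriented because 2K < b, every in-degree exactly K), and add a new
-- vertices with an arc to every vertex of the circulant. The centre and the w_i of a copy of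
-- S_{K+1,1} receive arcs, so they lie in the circulant, where the centre has only K
-- in-neighbours. There are b(a + K) = ⌊(n + K)/2⌋⌈(n + K)/2⌉ ≥ ⌊(n + K)²/4⌋ arcs.

open import Defs
open import Data.Bool using (Bool; true; false; if_then_else_; _∧_; not)
open import Data.Bool.Properties using (∧-identityʳ; ∧-zeroʳ; ∧-conicalˡ; ∧-conicalʳ; not-injective)
open import Data.Fin using (Fin; zero; suc; toℕ; punchIn; punchOut; splitAt; _↑ˡ_; _↑ʳ_)
open import Data.Fin.Properties
  using ( _≟_; any?; ¬Fin0; 0≢1+n; suc-injective; toℕ-injective; toℕ-fromℕ<; toℕ<n
        ; punchIn-punchOut; splitAt-↑ˡ; splitAt-↑ʳ; splitAt⁻¹-↑ʳ )
open import Data.List using (map; allFin; tabulate)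
open import Data.Nat
  using ( ℕ; zero; suc; pred; _+_; _*_; _∸_; _/_; _%_; _≤_; _<_; z≤n; s≤s; s≤s⁻¹; _≤?_; _<?_
        ; NonZero; >-nonZero; ⌊_/2⌋; ⌈_/2⌉ )
open import Data.Nat.DivMod
  using (_mod_; m≡m%n+[m/n]*n; %-distribˡ-+; m%n%n≡m%n; m<n⇒m%n≡m; m*n/n≡m; /-monoˡ-≤; m<n*o⇒m/o<n)
open import Data.Nat.Divisibility using (_∣_; divides; n∣m⇒m%n≡0)
open import Data.Nat.ListAction using (sum)
open import Data.Nat.Properties
  using ( module ≤-Reasoning; +-commutativeSemigroup; +-*-semiring
        ; ≤-refl; ≤-reflexive; ≤-trans; ≤-antisym; ≤-total; <⇒≤; ≤-<-trans; ≰⇒>; ≮⇒≥; n≮n; n≤1+n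
        ; +-comm; +-assoc; +-suc; +-identityʳ; *-comm; *-identityʳ; *-distribʳ-∸
        ; +-mono-≤; +-monoˡ-≤; +-monoʳ-≤; +-monoˡ-<; +-cancelˡ-≤; m≤m+n; m≤n+m
        ; m+[n∸m]≡n; m+n∸m≡n; m∸n+n≡m; m∸n≤m; +-∸-comm; [m+n]∸[m+o]≡n∸o
        ; ⌊n/2⌋-mono; ⌊n/2⌋+⌈n/2⌉≡n; n≡⌊n+n/2⌋ )
open import Data.Nat.Tactic.RingSolver using (solve-∀)
open import Data.Product using (Σ; ∃; _×_; _,_; proj₁; proj₂)
open import Data.Sum using (_⊎_; inj₁; inj₂; [_,_]′)
open import Data.Vec.Functional using (_∷_)
open import Function using (_∘_; Injective)
open import Relation.Binary.PropositionalEquality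
  using (_≡_; _≢_; refl; sym; trans; cong; cong₂; subst; subst₂; module ≡-Reasoning)
open import Relation.Nullary using (¬_; Dec; yes; no; does; contradiction)
open import Relation.Nullary.Decidable using (dec-true; dec-false)

open import Algebra.Properties.CommutativeSemigroup +-commutativeSemigroup using (x∙yz≈y∙xz)
open import Algebra.Properties.Semiring.Sum +-*-semiring
  using (sum-syntax; ∑-comm; ∑-distrib-+; sum-cong-≗; sum-replicate-zero; *-distribʳ-sum)

-- Finite sums and counting

𝟙 : Bool → ℕ
𝟙 b = if b then 1 else 0

sum-map-tabulate : ∀ {m n} (f : Fin n → ℕ) (g : Fin m → Fin n) →
                   sum (map f (tabulate g)) ≡ ∑[ i < m ] f (g i)
sum-map-tabulate {zero}  f g = refl
sum-map-tabulate {suc m} f g = cong (f (g zero) +_) (sum-map-tabulate f (g ∘ suc))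

sum-map-allFin : ∀ {n} (f : Fin n → ℕ) → sum (map f (allFin n)) ≡ ∑[ i < n ] f i
sum-map-allFin f = sum-map-tabulate f (λ i → i)

∑-mono-≤ : ∀ {n} {f g : Fin n → ℕ} → (∀ i → f i ≤ g i) → ∑[ i < n ] f i ≤ ∑[ i < n ] g i
∑-mono-≤ {zero}  f≤g = z≤n
∑-mono-≤ {suc n} f≤g = +-mono-≤ (f≤g zero) (∑-mono-≤ (f≤g ∘ suc))

∑-const : ∀ n c → ∑[ i < n ] c ≡ n * c
∑-const zero    c = refl
∑-const (suc n) c = cong (c +_) (∑-const n c)

∑-↑ : ∀ a {b} (f : Fin (a + b) → ℕ) →
      ∑[ x < a + b ] f x ≡ ∑[ i < a ] f (i ↑ˡ b) + ∑[ j < b ] f (a ↑ʳ j)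
∑-↑ zero    f = refl
∑-↑ (suc a) f = trans (cong (f zero +_) (∑-↑ a (f ∘ suc))) (sym (+-assoc (f zero) _ _))

count : ∀ {n} → (Fin n → Bool) → ℕ
count {n} P = ∑[ x < n ] 𝟙 (P x)

∑-if : ∀ {n} (P : Fin n → Bool) c d →
       ∑[ x < n ] (if P x then c else d) ≡ count P * c + count (not ∘ P) * d
∑-if {n} P c d = begin
  ∑[ x < n ] (if P x then c else d)
    ≡⟨ sum-cong-≗ {n} (λ x → if-as-𝟙 (P x)) ⟩
  ∑[ x < n ] (𝟙 (P x) * c + 𝟙 (not (P x)) * d)
    ≡⟨ ∑-distrib-+ {n} _ _ ⟩
  ∑[ x < n ] (𝟙 (P x) * c) + ∑[ x < n ] (𝟙 (not (P x)) * d)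
    ≡⟨ cong₂ _+_ (*-distribʳ-sum {n} c _) (*-distribʳ-sum {n} d _) ⟨
  count P * c + count (not ∘ P) * d
    ∎
  where
  open ≡-Reasoning
  if-as-𝟙 : ∀ b → (if b then c else d) ≡ 𝟙 b * c + 𝟙 (not b) * d
  if-as-𝟙 false = sym (+-identityʳ d)
  if-as-𝟙 true  = sym (trans (+-identityʳ (c + 0)) (+-identityʳ c))

count-cong : ∀ {n} {P Q : Fin n → Bool} → (∀ x → P x ≡ Q x) → count P ≡ count Q
count-cong P≗Q = sum-cong-≗ (cong 𝟙 ∘ P≗Q)

count-mono : ∀ {n} {P Q : Fin n → Bool} → (∀ x → P x ≡ true → Q x ≡ true) → count P ≤ count Q
count-mono {P = P} {Q} P⇒Q = ∑-mono-≤ (λ x → 𝟙-mono (P x) (Q x) (P⇒Q x))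
  where
  𝟙-mono : ∀ b c → (b ≡ true → c ≡ true) → 𝟙 b ≤ 𝟙 c
  𝟙-mono false c   _   = z≤n
  𝟙-mono true  c b⇒c rewrite b⇒c refl = ≤-refl

count-true : ∀ n → count {n} (λ _ → true) ≡ n
count-true n = trans (∑-const n 1) (*-identityʳ n)

count-split : ∀ {n} (P Q : Fin n → Bool) →
              count P ≡ count (λ x → P x ∧ Q x) + count (λ x → P x ∧ not (Q x))
count-split {n} P Q = trans (sum-cong-≗ {n} (λ x → 𝟙-split (P x) (Q x))) (∑-distrib-+ {n} _ _)
  where
  𝟙-split : ∀ b c → 𝟙 b ≡ 𝟙 (b ∧ c) + 𝟙 (b ∧ not c)
  𝟙-split false c     = refl
  𝟙-split true  false = refl
  𝟙-split true  true  = refl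

count-∧-not-≥ : ∀ {n} (P Q : Fin n → Bool) {m p} → m + p ≤ count P →
                count (λ x → P x ∧ Q x) ≤ m → p ≤ count (λ x → P x ∧ not (Q x))
count-∧-not-≥ P Q {m} {p} m+p≤ PQ≤m = +-cancelˡ-≤ m p _ (begin
  m + p                                                    ≤⟨ m+p≤ ⟩
  count P                                                  ≡⟨ count-split P Q ⟩
  count (λ x → P x ∧ Q x) + count (λ x → P x ∧ not (Q x))  ≤⟨ +-monoˡ-≤ _ PQ≤m ⟩
  m + count (λ x → P x ∧ not (Q x))                        ∎)
  where open ≤-Reasoning

dec-true⁻¹ : ∀ {p} {P : Set p} (p? : Dec P) → does p? ≡ true → P
dec-true⁻¹ (yes p) _ = p

dec-false⁻¹ : ∀ {p} {P : Set p} (p? : Dec P) → does p? ≡ false → ¬ P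
dec-false⁻¹ (no ¬p) _ = ¬p

_≡ᵇ_ : ∀ {n} → Fin n → Fin n → Bool
x ≡ᵇ y = does (x ≟ y)

≢⇒not-≡ᵇ : ∀ {n} {x y : Fin n} → x ≢ y → not (x ≡ᵇ y) ≡ true
≢⇒not-≡ᵇ {x = x} {y} x≢y = cong not (dec-false (x ≟ y) x≢y)

not-≡ᵇ⇒≢ : ∀ {n} {x y : Fin n} → not (x ≡ᵇ y) ≡ true → x ≢ y
not-≡ᵇ⇒≢ {x = x} {y} x≢ᵇy = dec-false⁻¹ (x ≟ y) (not-injective x≢ᵇy)

count-remove : ∀ {n} (P : Fin n → Bool) (c : Fin n) →
               count P ≡ 𝟙 (P c) + count (λ x → P x ∧ not (x ≡ᵇ c))
count-remove {suc n} P zero = cong (𝟙 (P zero) +_) (cong₂ _+_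
  (cong 𝟙 (sym (∧-zeroʳ (P zero))))
  (count-cong {n} (λ x → sym (∧-identityʳ (P (suc x))))))
count-remove {suc n} P (suc c) = begin
  𝟙 (P zero) + count (P ∘ suc)                 ≡⟨ cong (𝟙 (P zero) +_) (count-remove (P ∘ suc) c) ⟩
  𝟙 (P zero) + (𝟙 (P (suc c)) + rest)          ≡⟨ x∙yz≈y∙xz (𝟙 (P zero)) (𝟙 (P (suc c))) rest ⟩
  𝟙 (P (suc c)) + (𝟙 (P zero) + rest)          ≡⟨ cong (λ b → 𝟙 (P (suc c)) + (𝟙 b + rest)) (∧-identityʳ (P zero)) ⟨
  𝟙 (P (suc c)) + (𝟙 (P zero ∧ true) + rest)   ∎
  where
  open ≡-Reasoning
  rest : ℕ
  rest = count (λ x → P (suc x) ∧ not (x ≡ᵇ c))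

∷-injective : ∀ {k n} {x : Fin n} {w : Fin k → Fin n} →
              (∀ i → w i ≢ x) → Injective _≡_ _≡_ w → Injective _≡_ _≡_ (x ∷ w)
∷-injective fresh w-inj {zero}  {zero}  _     = refl
∷-injective fresh w-inj {zero}  {suc j} x≡wj  = contradiction (sym x≡wj) (fresh j)
∷-injective fresh w-inj {suc i} {zero}  wi≡x  = contradiction wi≡x (fresh i)
∷-injective fresh w-inj {suc i} {suc j} wi≡wj = cong suc (w-inj wi≡wj)

injection⇒≤count : ∀ {k n} {P : Fin n → Bool} (w : Fin k → Fin n) → Injective _≡_ _≡_ w →
                   (∀ i → P (w i) ≡ true) → k ≤ count P
injection⇒≤count {zero}  w _ _ = z≤n
injection⇒≤count {suc k} {P = P} w w-inj Pw = begin
  suc k                  ≤⟨ s≤s (injection⇒≤count (w ∘ suc) (suc-injective ∘ w-inj) P-rest) ⟩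
  suc rest               ≡⟨ cong (λ b → 𝟙 b + rest) (Pw zero) ⟨
  𝟙 (P (w zero)) + rest  ≡⟨ count-remove P (w zero) ⟨
  count P                ∎
  where
  open ≤-Reasoning
  rest : ℕ
  rest = count (λ x → P x ∧ not (x ≡ᵇ w zero))
  P-rest : ∀ i → P (w (suc i)) ∧ not (w (suc i) ≡ᵇ w zero) ≡ true
  P-rest i = cong₂ _∧_ (Pw (suc i)) (≢⇒not-≡ᵇ (λ e → 0≢1+n (sym (w-inj e))))

covered⇒count≤ : ∀ {k n} {P : Fin n → Bool} (w : Fin k → Fin n) →
                 (∀ x → P x ≡ true → ∃ λ i → w i ≡ x) → count P ≤ k
covered⇒count≤ {zero} {n} {P} w cover = begin
  count P                  ≤⟨ count-mono (λ x Px → contradiction (proj₁ (cover x Px)) ¬Fin0) ⟩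
  count {n} (λ _ → false)  ≡⟨ sum-replicate-zero n ⟩
  0                        ∎
  where open ≤-Reasoning
covered⇒count≤ {suc k} {P = P} w cover = begin
  count P                 ≡⟨ count-remove P (w zero) ⟩
  𝟙 (P (w zero)) + rest   ≤⟨ +-mono-≤ (𝟙≤1 (P (w zero))) (covered⇒count≤ (w ∘ suc) cover-rest) ⟩
  suc k                   ∎
  where
  open ≤-Reasoning
  rest : ℕ
  rest = count (λ x → P x ∧ not (x ≡ᵇ w zero))
  𝟙≤1 : ∀ b → 𝟙 b ≤ 1
  𝟙≤1 false = z≤n
  𝟙≤1 true  = ≤-refl
  cover-rest : ∀ x → P x ∧ not (x ≡ᵇ w zero) ≡ true → ∃ λ i → w (suc i) ≡ x
  cover-rest x e with cover x (∧-conicalˡ _ _ e)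
  ... | zero  , w0≡x = contradiction (sym w0≡x) (not-≡ᵇ⇒≢ (∧-conicalʳ _ _ e))
  ... | suc i , wi≡x = i , wi≡x

≤count⇒injection : ∀ {m n} (P : Fin n → Bool) → m ≤ count P →
                   Σ (Fin m → Fin n) λ w → Injective _≡_ _≡_ w × (∀ i → P (w i) ≡ true)
≤count⇒injection {zero}  P _ = (λ ()) , (λ {i} → contradiction i ¬Fin0) , (λ ())
≤count⇒injection {suc m} {suc n} P m<count = extend refl m<count
  where
  extend : ∀ {b} → P zero ≡ b → suc m ≤ 𝟙 b + count (P ∘ suc) →
           Σ (Fin (suc m) → Fin (suc n)) λ w → Injective _≡_ _≡_ w × (∀ i → P (w i) ≡ true)
  extend {false} _ m<rest =
    let w , w-inj , Pw = ≤count⇒injection (P ∘ suc) m<rest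
    in suc ∘ w , w-inj ∘ suc-injective , Pw
  extend {true} P0 m<rest =
    let w , w-inj , Pw = ≤count⇒injection (P ∘ suc) (s≤s⁻¹ m<rest)
    in zero ∷ suc ∘ w , ∷-injective (λ i → 0≢1+n ∘ sym) (w-inj ∘ suc-injective) ,
       λ { zero → P0 ; (suc i) → Pw i }

image : ∀ {k n} → (Fin k → Fin n) → Fin n → Bool
image w x = does (any? λ i → w i ≟ x)

image⁻¹ : ∀ {k n} (w : Fin k → Fin n) x → image w x ≡ true → ∃ λ i → w i ≡ x
image⁻¹ w x = dec-true⁻¹ (any? λ i → w i ≟ x)

∉-image : ∀ {k n} (w : Fin k → Fin n) x → not (image w x) ≡ true → ∀ i → w i ≢ x
∉-image w x x∉w i wi≡x = dec-false⁻¹ (any? λ j → w j ≟ x) (not-injective x∉w) (i , wi≡x)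

count-pos⇒∃ : ∀ {n} (P : Fin n → Bool) → 1 ≤ count P → ∃ λ x → P x ≡ true
count-pos⇒∃ P pos = let w , _ , Pw = ≤count⇒injection P pos in w zero , Pw zero

distinctRepresentatives : ∀ {m n} (S : Fin m → Fin n → Bool) → (∀ i → m ≤ count (S i)) →
                          Σ (Fin m → Fin n) λ z → Injective _≡_ _≡_ z × (∀ i → S i (z i) ≡ true)
distinctRepresentatives {zero}  S _ = (λ ()) , (λ {i} → contradiction i ¬Fin0) , (λ ())
distinctRepresentatives {suc m} {n} S large =
  extend (distinctRepresentatives (S ∘ suc) (λ i → <⇒≤ (large (suc i))))
  where
  extend : (Σ (Fin m → Fin n) λ z → Injective _≡_ _≡_ z × (∀ i → S (suc i) (z i) ≡ true)) →
           Σ (Fin (suc m) → Fin n) λ z → Injective _≡_ _≡_ z × (∀ i → S i (z i) ≡ true)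
  extend (z , z-inj , Sz) with count-pos⇒∃ (λ y → S zero y ∧ not (image z y)) S₀-outside-z
    where
    S₀-outside-z : 1 ≤ count (λ y → S zero y ∧ not (image z y))
    S₀-outside-z = count-∧-not-≥ (S zero) (image z) (≤-trans (≤-reflexive (+-comm m 1)) (large zero))
                     (covered⇒count≤ z λ y → image⁻¹ z y ∘ ∧-conicalʳ _ _)
  ... | x , S₀x∧x∉z = x ∷ z , ∷-injective (∉-image z x (∧-conicalʳ (S zero x) _ S₀x∧x∉z)) z-inj ,
                      λ { zero → ∧-conicalˡ _ _ S₀x∧x∉z ; (suc i) → Sz i }

-- Copies of S_{k,1} and the upper bound

indegree : ∀ {n} → Digraph n → Fin n → ℕ
indegree A y = count (λ x → A x y)

arcCount≡∑indegree : ∀ {n} (A : Digraph n) → arcCount A ≡ ∑[ y < n ] indegree A y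
arcCount≡∑indegree {n} A = begin
  arcCount A                                         ≡⟨ sum-map-allFin {n} _ ⟩
  ∑[ x < n ] sum (map (λ y → 𝟙 (A x y)) (allFin n))  ≡⟨ sum-cong-≗ {n} (λ x → sum-map-allFin {n} _) ⟩
  ∑[ x < n ] ∑[ y < n ] 𝟙 (A x y)                    ≡⟨ ∑-comm (λ x y → 𝟙 (A x y)) ⟩
  ∑[ y < n ] ∑[ x < n ] 𝟙 (A x y)                    ∎
  where open ≡-Reasoning

no-loop : ∀ {n} {A : Digraph n} → (∀ x → A x x ≡ false) → ∀ x → ¬ (A x x ≡ true)
no-loop loopless x loop = contradiction (trans (sym loop) (loopless x)) λ ()

in-neighbours-in-image≤ : ∀ {n k} {A : Digraph n} → (∀ x → A x x ≡ false) →
                          (w : Fin (suc k) → Fin n) (i : Fin (suc k)) →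
                          count (λ x → A x (w i) ∧ image w x) ≤ k
in-neighbours-in-image≤ {A = A} loopless w i = covered⇒count≤ (w ∘ punchIn i) cover
  where
  cover : ∀ x → A x (w i) ∧ image w x ≡ true → ∃ λ j → w (punchIn i j) ≡ x
  cover x e with image⁻¹ w x (∧-conicalʳ _ _ e)
  ... | j , wj≡x = punchOut i≢j , trans (cong w (punchIn-punchOut i≢j)) wj≡x
    where
    i≢j : i ≢ j
    i≢j refl = no-loop {A = A} loopless (w i) (subst (λ y → A y (w i) ≡ true) (sym wj≡x) (∧-conicalˡ _ _ e))

high-in-neighbours⇒copy : ∀ {n K} {A : Digraph n} → IsOriented A →
                          (v : Fin n) (w : Fin (suc K) → Fin n) → Injective _≡_ _≡_ w →
                          (∀ i → A (w i) v ≡ true) → (∀ i → suc (K + K) ≤ indegree A (w i)) →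
                          CopyOfS (suc K) A
high-in-neighbours⇒copy {n} {K} {A} (loopless , antisym) v w w-inj wv large =
  copy (distinctRepresentatives (λ i x → A x (w i) ∧ not (image w x)) many-outside)
  where
  many-outside : ∀ i → suc K ≤ count (λ x → A x (w i) ∧ not (image w x))
  many-outside i = count-∧-not-≥ (λ x → A x (w i)) (image w)
                     (≤-trans (≤-reflexive (+-suc K K)) (large i))
                     (in-neighbours-in-image≤ {A = A} loopless w i)

  copy : (Σ (Fin (suc K) → Fin n) λ z →
           Injective _≡_ _≡_ z × (∀ i → A (z i) (w i) ∧ not (image w (z i)) ≡ true)) →
         CopyOfS (suc K) A
  copy (z , z-inj , fresh-zw) = record
    { v = v ; w = w ; z = z
    ; w-inj = λ _ _ → w-inj
    ; z-inj = λ _ _ → z-inj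
    ; w≢z = λ i j → ∉-image w (z j) (∧-conicalʳ (A (z j) (w j)) _ (fresh-zw j)) i
    ; v≢w = λ i v≡wi → no-loop {A = A} loopless (w i) (wv-at v≡wi)
    ; v≢z = λ i v≡zi → antisym (z i) (w i) (zw i , wv-at v≡zi)
    ; arc-zw = zw
    ; arc-wv = wv
    }
    where
    zw : ∀ i → A (z i) (w i) ≡ true
    zw i = ∧-conicalˡ _ _ (fresh-zw i)
    wv-at : ∀ {i y} → v ≡ y → A (w i) y ≡ true
    wv-at refl = wv _

m*n*4≤[m+n]*[m+n] : ∀ m n → m * n * 4 ≤ (m + n) * (m + n)
m*n*4≤[m+n]*[m+n] m n = [ ordered , swapped ]′ (≤-total m n)
  where
  square-split : ∀ m d → (m + (m + d)) * (m + (m + d)) ≡ m * (m + d) * 4 + d * d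
  square-split = solve-∀
  ordered : ∀ {m n} → m ≤ n → m * n * 4 ≤ (m + n) * (m + n)
  ordered {m} {n} m≤n = subst (λ k → m * k * 4 ≤ (m + k) * (m + k)) (m+[n∸m]≡n m≤n)
    (≤-trans (m≤m+n _ _) (≤-reflexive (sym (square-split m (n ∸ m)))))
  swapped : n ≤ m → m * n * 4 ≤ (m + n) * (m + n)
  swapped n≤m = subst₂ _≤_ (cong (_* 4) (*-comm n m)) (cong (λ s → s * s) (+-comm n m)) (ordered n≤m)

m*n≤[m+n]*[m+n]/4 : ∀ m n → m * n ≤ (m + n) * (m + n) / 4
m*n≤[m+n]*[m+n]/4 m n = begin
  m * n                  ≡⟨ m*n/n≡m (m * n) 4 ⟨
  m * n * 4 / 4          ≤⟨ /-monoˡ-≤ 4 (m*n*4≤[m+n]*[m+n] m n) ⟩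
  (m + n) * (m + n) / 4  ∎
  where open ≤-Reasoning

module UpperBound {n : ℕ} (A : Digraph n) (K : ℕ) (oriented : IsOriented A) (free : SFree (suc K) A) where

  high : Fin n → Bool
  high x = does (suc (K + K) ≤? indegree A x)

  h l : ℕ
  h = count high
  l = count (not ∘ high)

  h+l≡n : h + l ≡ n
  h+l≡n = trans (sym (count-split (λ _ → true) high)) (count-true n)

  high-in-neighbours≤ : ∀ v → count (λ x → A x v ∧ high x) ≤ K
  high-in-neighbours≤ v with K <? count (λ x → A x v ∧ high x)
  ... | no  K≮ = ≮⇒≥ K≮
  ... | yes K< = contradiction (copy (≤count⇒injection (λ x → A x v ∧ high x) K<)) free
    where
    copy : (Σ (Fin (suc K) → Fin n) λ w → Injective _≡_ _≡_ w × (∀ i → A (w i) v ∧ high (w i) ≡ true)) →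
           CopyOfS (suc K) A
    copy (w , w-inj , high-wv) = high-in-neighbours⇒copy oriented v w w-inj
      (λ i → ∧-conicalˡ _ _ (high-wv i))
      (λ i → dec-true⁻¹ (_ ≤? _) (∧-conicalʳ (A (w i) v) _ (high-wv i)))

  indegree≤ : ∀ y → indegree A y ≤ K + (if high y then l else K)
  indegree≤ y with high y in high-y
  ... | true  = begin
    indegree A y                                                       ≡⟨ count-split (λ x → A x y) high ⟩
    count (λ x → A x y ∧ high x) + count (λ x → A x y ∧ not (high x))  ≤⟨ +-mono-≤ (high-in-neighbours≤ y) low≤l ⟩
    K + l                                                              ∎
    where
    open ≤-Reasoning
    low≤l : count (λ x → A x y ∧ not (high x)) ≤ l
    low≤l = count-mono λ x → ∧-conicalʳ (A x y) _
  ... | false = s≤s⁻¹ (≰⇒> (dec-false⁻¹ (suc (K + K) ≤? indegree A y) high-y))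

  arcCount≤ : arcCount A ≤ (n + K) * (n + K) / 4 + K * n
  arcCount≤ = begin
    arcCount A                                           ≡⟨ arcCount≡∑indegree A ⟩
    ∑[ y < n ] indegree A y                              ≤⟨ ∑-mono-≤ indegree≤ ⟩
    ∑[ y < n ] (K + (if high y then l else K))           ≡⟨ ∑-distrib-+ {n} _ _ ⟩
    ∑[ y < n ] K + ∑[ y < n ] (if high y then l else K)  ≡⟨ cong₂ _+_ (∑-const n K) (∑-if high l K) ⟩
    n * K + (h * l + l * K)                              ≡⟨ regroup n h l K ⟩
    l * (h + K) + K * n                                  ≤⟨ +-monoˡ-≤ (K * n) (m*n≤[m+n]*[m+n]/4 l (h + K)) ⟩
    (l + (h + K)) * (l + (h + K)) / 4 + K * n            ≡⟨ cong (λ m → m * m / 4 + K * n) l+h+K≡n+K ⟩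
    (n + K) * (n + K) / 4 + K * n                        ∎
    where
    open ≤-Reasoning
    regroup : ∀ n h l K → n * K + (h * l + l * K) ≡ l * (h + K) + K * n
    regroup = solve-∀
    l+h+K≡n+K : l + (h + K) ≡ n + K
    l+h+K≡n+K = trans (sym (+-assoc l h K)) (cong (_+ K) (trans (+-comm l h) h+l≡n))

-- The circulant

[m%n+k]%n≡[m+k]%n : ∀ m k n .{{_ : NonZero n}} → (m % n + k) % n ≡ (m + k) % n
[m%n+k]%n≡[m+k]%n m k n = begin
  (m % n + k) % n          ≡⟨ %-distribˡ-+ (m % n) k n ⟩
  (m % n % n + k % n) % n  ≡⟨ cong (λ r → (r + k % n) % n) (m%n%n≡m%n m n) ⟩
  (m % n + k % n) % n      ≡⟨ %-distribˡ-+ m k n ⟨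
  (m + k) % n              ∎
  where open ≡-Reasoning

[m+t]%n≡m%n⇒n∣t : ∀ m t n .{{_ : NonZero n}} → (m + t) % n ≡ m % n → n ∣ t
[m+t]%n≡m%n⇒n∣t m t n eq = divides ((m + t) / n ∸ m / n) (begin
  t                                                    ≡⟨ m+n∸m≡n m t ⟨
  m + t ∸ m                                            ≡⟨ cong₂ _∸_ (m≡m%n+[m/n]*n (m + t) n) (m≡m%n+[m/n]*n m n) ⟩
  (m + t) % n + (m + t) / n * n ∸ (m % n + m / n * n)  ≡⟨ cong (λ r → r + (m + t) / n * n ∸ (m % n + m / n * n)) eq ⟩
  m % n + (m + t) / n * n ∸ (m % n + m / n * n)        ≡⟨ [m+n]∸[m+o]≡n∸o (m % n) _ _ ⟩
  (m + t) / n * n ∸ m / n * n                          ≡⟨ *-distribʳ-∸ n ((m + t) / n) (m / n) ⟨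
  ((m + t) / n ∸ m / n) * n                            ∎)
  where open ≡-Reasoning

+-%-injectiveʳ : ∀ m {d e n} .{{_ : NonZero n}} → d < n → e < n → (m + d) % n ≡ (m + e) % n → d ≡ e
+-%-injectiveʳ m {d} {e} {n} d<n e<n eq =
  [ (λ d≤e → sym (ordered d≤e e<n eq)) , (λ e≤d → ordered e≤d d<n (sym eq)) ]′ (≤-total d e)
  where
  ordered : ∀ {d e} → d ≤ e → e < n → (m + d) % n ≡ (m + e) % n → e ≡ d
  ordered {d} {e} d≤e e<n eq = begin
    e      ≡⟨ m+[n∸m]≡n d≤e ⟨
    d + t  ≡⟨ cong (d +_) t≡0 ⟩
    d + 0  ≡⟨ +-identityʳ d ⟩
    d      ∎
    where
    open ≡-Reasoning
    t : ℕ
    t = e ∸ d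
    [m+d+t]%n≡[m+d]%n : (m + d + t) % n ≡ (m + d) % n
    [m+d+t]%n≡[m+d]%n = trans (cong (_% n) (trans (+-assoc m d t) (cong (m +_) (m+[n∸m]≡n d≤e)))) (sym eq)
    t≡0 : t ≡ 0
    t≡0 = trans (sym (m<n⇒m%n≡m (≤-<-trans (m∸n≤m e d) e<n)))
                (n∣m⇒m%n≡0 t n ([m+t]%n≡m%n⇒n∣t (m + d) t n [m+d+t]%n≡[m+d]%n))

shift : ∀ {b} .{{_ : NonZero b}} → Fin b → ℕ → Fin b
shift {b} q d = (toℕ q + d) mod b

module _ {b : ℕ} .{{_ : NonZero b}} where

  toℕ-shift : ∀ (q : Fin b) d → toℕ (shift q d) ≡ (toℕ q + d) % b
  toℕ-shift q d = toℕ-fromℕ< _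

  shift-zero : ∀ (q : Fin b) → shift q 0 ≡ q
  shift-zero q = toℕ-injective (begin
    toℕ (shift q 0)  ≡⟨ toℕ-shift q 0 ⟩
    (toℕ q + 0) % b  ≡⟨ cong (_% b) (+-identityʳ (toℕ q)) ⟩
    toℕ q % b        ≡⟨ m<n⇒m%n≡m (toℕ<n q) ⟩
    toℕ q            ∎)
    where open ≡-Reasoning

  shift-shift : ∀ (q : Fin b) d e → shift (shift q d) e ≡ shift q (d + e)
  shift-shift q d e = toℕ-injective (begin
    toℕ (shift (shift q d) e)  ≡⟨ toℕ-shift (shift q d) e ⟩
    (toℕ (shift q d) + e) % b  ≡⟨ cong (λ r → (r + e) % b) (toℕ-shift q d) ⟩
    ((toℕ q + d) % b + e) % b  ≡⟨ [m%n+k]%n≡[m+k]%n (toℕ q + d) e b ⟩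
    (toℕ q + d + e) % b        ≡⟨ cong (_% b) (+-assoc (toℕ q) d e) ⟩
    (toℕ q + (d + e)) % b      ≡⟨ toℕ-shift q (d + e) ⟨
    toℕ (shift q (d + e))      ∎)
    where open ≡-Reasoning

  shift-injective : ∀ (q : Fin b) {d e} → d < b → e < b → shift q d ≡ shift q e → d ≡ e
  shift-injective q d<b e<b eq = +-%-injectiveʳ (toℕ q) d<b e<b
    (trans (sym (toℕ-shift q _)) (trans (cong toℕ eq) (toℕ-shift q _)))

circulant : ∀ b .{{_ : NonZero b}} → ℕ → Digraph b
circulant b K p q = does (any? λ (j : Fin K) → shift q (suc (toℕ j)) ≟ p)

module _ {b : ℕ} .{{_ : NonZero b}} {K : ℕ} where

  circulant⁻¹ : ∀ {p q} → circulant b K p q ≡ true → ∃ λ (j : Fin K) → shift q (suc (toℕ j)) ≡ p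
  circulant⁻¹ {p} {q} = dec-true⁻¹ (any? λ j → shift q (suc (toℕ j)) ≟ p)

  circulant-oriented : K + K < b → IsOriented (circulant b K)
  circulant-oriented 2K<b = loopless , antisym
    where
    K<b : K < b
    K<b = ≤-<-trans (m≤m+n K K) 2K<b
    loopless : ∀ q → circulant b K q q ≡ false
    loopless q = dec-false (any? λ j → shift q (suc (toℕ j)) ≟ q) λ { (j , qj≡q) →
      contradiction (shift-injective q (≤-<-trans (toℕ<n j) K<b) (≤-<-trans z≤n K<b)
                       (trans qj≡q (sym (shift-zero q)))) λ () }
    antisym : ∀ p q → ¬ (circulant b K p q ≡ true × circulant b K q p ≡ true)
    antisym p q (pq , qp) with circulant⁻¹ pq | circulant⁻¹ qp
    ... | j , qj≡p | j′ , pj′≡q =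
      contradiction (shift-injective q (≤-<-trans (+-mono-≤ (toℕ<n j) (toℕ<n j′)) 2K<b) (≤-<-trans z≤n K<b)
                      (begin
                        shift q (suc (toℕ j) + suc (toℕ j′))  ≡⟨ shift-shift q _ _ ⟨
                        shift (shift q (suc (toℕ j))) _       ≡⟨ cong (λ r → shift r (suc (toℕ j′))) qj≡p ⟩
                        shift p (suc (toℕ j′))                ≡⟨ pj′≡q ⟩
                        q                                     ≡⟨ shift-zero q ⟨
                        shift q 0                             ∎))
        λ ()
      where open ≡-Reasoning

  indegree-circulant : K < b → ∀ q → indegree (circulant b K) q ≡ K
  indegree-circulant K<b q = ≤-antisym
    (covered⇒count≤ offsets (λ p → circulant⁻¹))
    (injection⇒≤count offsets offsets-injective (λ j → dec-true (any? _) (j , refl)))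
    where
    offsets : Fin K → Fin b
    offsets j = shift q (suc (toℕ j))
    offsets-injective : Injective _≡_ _≡_ offsets
    offsets-injective {i} {j} eq =
      toℕ-injective (cong pred (shift-injective q (≤-<-trans (toℕ<n i) K<b) (≤-<-trans (toℕ<n j) K<b) eq))

-- The lower bound

sourceArc : ∀ {a b} → Digraph b → Fin a ⊎ Fin b → Fin a ⊎ Fin b → Bool
sourceArc C _        (inj₁ _) = false
sourceArc C (inj₁ _) (inj₂ _) = true
sourceArc C (inj₂ p) (inj₂ q) = C p q

withSources : ∀ a {b} → Digraph b → Digraph (a + b)
withSources a C x y = sourceArc C (splitAt a x) (splitAt a y)

isInner : ∀ a {b} → Fin (a + b) → Bool
isInner a x = [ (λ _ → false) , (λ _ → true) ]′ (splitAt a x)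

module _ (a : ℕ) {b : ℕ} (C : Digraph b) where

  private
    A : Digraph (a + b)
    A = withSources a C
    inner : Fin (a + b) → Bool
    inner = isInner a {b}

  withSources-↑ˡ-↑ʳ : ∀ i q → A (i ↑ˡ b) (a ↑ʳ q) ≡ true
  withSources-↑ˡ-↑ʳ i q = cong₂ (sourceArc C) (splitAt-↑ˡ a i b) (splitAt-↑ʳ a b q)

  withSources-↑ʳ-↑ʳ : ∀ p q → A (a ↑ʳ p) (a ↑ʳ q) ≡ C p q
  withSources-↑ʳ-↑ʳ p q = cong₂ (sourceArc C) (splitAt-↑ʳ a b p) (splitAt-↑ʳ a b q)

  isInner-↑ˡ : ∀ i → inner (i ↑ˡ b) ≡ false
  isInner-↑ˡ i = cong [ (λ _ → false) , (λ _ → true) ]′ (splitAt-↑ˡ a i b)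

  isInner-↑ʳ : ∀ p → inner (a ↑ʳ p) ≡ true
  isInner-↑ʳ p = cong [ (λ _ → false) , (λ _ → true) ]′ (splitAt-↑ʳ a b p)

  isInner⁻¹ : ∀ y → inner y ≡ true → ∃ λ q → a ↑ʳ q ≡ y
  isInner⁻¹ y _ with splitAt a y in y-split
  ... | inj₂ q = q , splitAt⁻¹-↑ʳ y-split

  arc⇒isInner : ∀ x y → A x y ≡ true → inner y ≡ true
  arc⇒isInner x y _ with splitAt a x | splitAt a y
  ... | _ | inj₂ _ = refl

  withSources-oriented : IsOriented C → IsOriented A
  withSources-oriented (loopless , antisym) =
    (λ x → loopless′ (splitAt a x)) , (λ x y → antisym′ (splitAt a x) (splitAt a y))
    where
    loopless′ : ∀ s → sourceArc C s s ≡ false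
    loopless′ (inj₁ _) = refl
    loopless′ (inj₂ p) = loopless p
    antisym′ : ∀ s t → ¬ (sourceArc C s t ≡ true × sourceArc C t s ≡ true)
    antisym′ (inj₁ _) (inj₁ _) (() , _)
    antisym′ (inj₁ _) (inj₂ _) (_ , ())
    antisym′ (inj₂ _) (inj₁ _) (() , _)
    antisym′ (inj₂ p) (inj₂ q) = antisym p q

  indegree-withSources : ∀ q → indegree A (a ↑ʳ q) ≡ a + indegree C q
  indegree-withSources q = begin
    indegree A (a ↑ʳ q)                                                      ≡⟨ ∑-↑ a _ ⟩
    ∑[ i < a ] 𝟙 (A (i ↑ˡ b) (a ↑ʳ q)) + ∑[ p < b ] 𝟙 (A (a ↑ʳ p) (a ↑ʳ q))  ≡⟨ cong₂ _+_ from-sources from-inner ⟩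
    a + indegree C q                                                         ∎
    where
    open ≡-Reasoning
    from-sources : ∑[ i < a ] 𝟙 (A (i ↑ˡ b) (a ↑ʳ q)) ≡ a
    from-sources = trans (sum-cong-≗ {a} (λ i → cong 𝟙 (withSources-↑ˡ-↑ʳ i q))) (count-true a)
    from-inner : ∑[ p < b ] 𝟙 (A (a ↑ʳ p) (a ↑ʳ q)) ≡ indegree C q
    from-inner = sum-cong-≗ {b} (λ p → cong 𝟙 (withSources-↑ʳ-↑ʳ p q))

  inner-in-neighbours : ∀ q → count (λ x → A x (a ↑ʳ q) ∧ inner x) ≡ indegree C q
  inner-in-neighbours q = begin
    count (λ x → A x (a ↑ʳ q) ∧ inner x)                 ≡⟨ ∑-↑ a _ ⟩
    ∑[ i < a ] 𝟙 (A (i ↑ˡ b) (a ↑ʳ q) ∧ inner (i ↑ˡ b)) +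
    ∑[ p < b ] 𝟙 (A (a ↑ʳ p) (a ↑ʳ q) ∧ inner (a ↑ʳ p))  ≡⟨ cong₂ _+_ from-sources from-inner ⟩
    0 + indegree C q                                     ∎
    where
    open ≡-Reasoning
    from-sources : ∑[ i < a ] 𝟙 (A (i ↑ˡ b) (a ↑ʳ q) ∧ inner (i ↑ˡ b)) ≡ 0
    from-sources = trans (sum-cong-≗ {a} (λ i → cong 𝟙 (cong₂ _∧_ (withSources-↑ˡ-↑ʳ i q) (isInner-↑ˡ i))))
                         (sum-replicate-zero a)
    from-inner : ∑[ p < b ] 𝟙 (A (a ↑ʳ p) (a ↑ʳ q) ∧ inner (a ↑ʳ p)) ≡ indegree C q
    from-inner = sum-cong-≗ {b} (λ p → cong 𝟙 (trans (cong₂ _∧_ (withSources-↑ʳ-↑ʳ p q) (isInner-↑ʳ p))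
                                                      (∧-identityʳ (C p q))))

  withSources-free : ∀ {K} → (∀ q → indegree C q ≤ K) → SFree (suc K) A
  withSources-free {K} ≤K copy = n≮n K (begin-strict
    K                                     <⟨ injection⇒≤count w (λ {i} {j} → w-inj i j) inner-in-neighbour ⟩
    count (λ x → A x (a ↑ʳ q) ∧ inner x)  ≡⟨ inner-in-neighbours q ⟩
    indegree C q                          ≤⟨ ≤K q ⟩
    K                                     ∎)
    where
    open ≤-Reasoning
    open CopyOfS copy
    centre : ∃ λ q → a ↑ʳ q ≡ v
    centre = isInner⁻¹ v (arc⇒isInner (w zero) v (arc-wv zero))
    q : Fin b
    q = proj₁ centre
    inner-in-neighbour : ∀ i → A (w i) (a ↑ʳ q) ∧ inner (w i) ≡ true
    inner-in-neighbour i = cong₂ _∧_ (subst (λ y → A (w i) y ≡ true) (sym (proj₂ centre)) (arc-wv i))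
                                     (arc⇒isInner (z i) (w i) (arc-zw i))

  withSources-arcCount : ∀ {K} → (∀ q → K ≤ indegree C q) → b * (a + K) ≤ arcCount A
  withSources-arcCount {K} K≤ = begin
    b * (a + K)                                                      ≡⟨ ∑-const b (a + K) ⟨
    ∑[ q < b ] (a + K)                                               ≤⟨ ∑-mono-≤ (λ q → +-monoʳ-≤ a (K≤ q)) ⟩
    ∑[ q < b ] (a + indegree C q)                                    ≡⟨ sum-cong-≗ {b} (sym ∘ indegree-withSources) ⟩
    ∑[ q < b ] indegree A (a ↑ʳ q)                                   ≤⟨ m≤n+m _ _ ⟩
    ∑[ i < a ] indegree A (i ↑ˡ b) + ∑[ q < b ] indegree A (a ↑ʳ q)  ≡⟨ ∑-↑ a _ ⟨
    ∑[ y < a + b ] indegree A y                                      ≡⟨ arcCount≡∑indegree A ⟨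
    arcCount A                                                       ∎
    where open ≤-Reasoning

m*m<[1+⌊m/2⌋*⌈m/2⌉]*4 : ∀ m → m * m < suc (⌊ m /2⌋ * ⌈ m /2⌉) * 4
m*m<[1+⌊m/2⌋*⌈m/2⌉]*4 0 = s≤s z≤n
m*m<[1+⌊m/2⌋*⌈m/2⌉]*4 1 = s≤s (s≤s z≤n)
m*m<[1+⌊m/2⌋*⌈m/2⌉]*4 (suc (suc m)) = begin-strict
  (2 + m) * (2 + m)                    ≡⟨ expand m ⟩
  m * m + (m * 4 + 4)                  <⟨ +-monoˡ-< (m * 4 + 4) (m*m<[1+⌊m/2⌋*⌈m/2⌉]*4 m) ⟩
  suc (f * c) * 4 + (m * 4 + 4)        ≡⟨ cong (λ t → suc (f * c) * 4 + (t * 4 + 4)) (⌊n/2⌋+⌈n/2⌉≡n m) ⟨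
  suc (f * c) * 4 + ((f + c) * 4 + 4)  ≡⟨ regroup f c ⟩
  suc (suc f * suc c) * 4              ∎
  where
  open ≤-Reasoning
  f c : ℕ
  f = ⌊ m /2⌋
  c = ⌈ m /2⌉
  expand : ∀ m → (2 + m) * (2 + m) ≡ m * m + (m * 4 + 4)
  expand = solve-∀
  regroup : ∀ f c → suc (f * c) * 4 + ((f + c) * 4 + 4) ≡ suc (suc f * suc c) * 4
  regroup = solve-∀

m*m/4≤⌊m/2⌋*⌈m/2⌉ : ∀ m → m * m / 4 ≤ ⌊ m /2⌋ * ⌈ m /2⌉
m*m/4≤⌊m/2⌋*⌈m/2⌉ m = s≤s⁻¹ (m<n*o⇒m/o<n (m*m<[1+⌊m/2⌋*⌈m/2⌉]*4 m))

sourcesOverCirculant : ∀ a b K → K + K < b →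
  Σ (Digraph (a + b)) λ A → IsOriented A × SFree (suc K) A × b * (a + K) ≤ arcCount A
sourcesOverCirculant a b K 2K<b =
  withSources a C ,
  withSources-oriented a C (circulant-oriented {K = K} 2K<b) ,
  withSources-free a C (≤-reflexive ∘ indegree-circulant K<b) ,
  withSources-arcCount a C (≤-reflexive ∘ sym ∘ indegree-circulant K<b)
  where
  instance
    b≢0 : NonZero b
    b≢0 = >-nonZero (≤-<-trans z≤n 2K<b)
  K<b : K < b
  K<b = ≤-<-trans (m≤m+n K K) 2K<b
  C : Digraph b
  C = circulant b K

lowerBound : ∀ n K → 3 * suc K + 1 ≤ n →
             Σ (Digraph n) λ A → IsOriented A × SFree (suc K) A × (n + K) * (n + K) / 4 ≤ arcCount A
lowerBound n K large = resize (sourcesOverCirculant a b K 2K<b)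
  where
  b a : ℕ
  b = ⌊ n + K /2⌋
  a = n ∸ b

  2K<b : K + K < b
  2K<b = begin-strict
    K + K                                    <⟨ s≤s (+-monoʳ-≤ K (n≤1+n K)) ⟩
    suc K + suc K                            ≡⟨ n≡⌊n+n/2⌋ (suc K + suc K) ⟩
    ⌊ (suc K + suc K) + (suc K + suc K) /2⌋  ≤⟨ ⌊n/2⌋-mono (≤-trans (≤-reflexive (regroup K)) (+-monoˡ-≤ K large)) ⟩
    b                                        ∎
    where
    open ≤-Reasoning
    regroup : ∀ K → (suc K + suc K) + (suc K + suc K) ≡ 3 * suc K + 1 + K
    regroup = solve-∀

  b≤n : b ≤ n
  b≤n = ≤-trans (⌊n/2⌋-mono (+-monoʳ-≤ n K≤n)) (≤-reflexive (sym (n≡⌊n+n/2⌋ n)))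
    where
    K≤n : K ≤ n
    K≤n = ≤-trans (n≤1+n K) (≤-trans (m≤m+n (suc K) _) (≤-trans (m≤m+n _ 1) large))

  a+K≡⌈n+K/2⌉ : a + K ≡ ⌈ n + K /2⌉
  a+K≡⌈n+K/2⌉ = begin
    n ∸ b + K            ≡⟨ +-∸-comm K b≤n ⟨
    n + K ∸ b            ≡⟨ cong (_∸ b) (⌊n/2⌋+⌈n/2⌉≡n (n + K)) ⟨
    b + ⌈ n + K /2⌉ ∸ b  ≡⟨ m+n∸m≡n b _ ⟩
    ⌈ n + K /2⌉          ∎
    where open ≡-Reasoning

  square/4≤b*[a+K] : (n + K) * (n + K) / 4 ≤ b * (a + K)
  square/4≤b*[a+K] = ≤-trans (m*m/4≤⌊m/2⌋*⌈m/2⌉ (n + K)) (≤-reflexive (cong (b *_) (sym a+K≡⌈n+K/2⌉)))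

  resize : (Σ (Digraph (a + b)) λ A → IsOriented A × SFree (suc K) A × b * (a + K) ≤ arcCount A) →
           Σ (Digraph n) λ A → IsOriented A × SFree (suc K) A × (n + K) * (n + K) / 4 ≤ arcCount A
  resize (A , oriented , free , arcs) =
    subst (λ m → Σ (Digraph m) λ A → IsOriented A × SFree (suc K) A × (n + K) * (n + K) / 4 ≤ arcCount A)
      (m∸n+n≡m b≤n) (A , oriented , free , ≤-trans square/4≤b*[a+K] arcs)

-- The hypothesis k ≥ 4 is only used to exclude k = 0: both bounds hold for every k ≥ 1
-- with n ≥ 3k + 1.
theorem1p3 : (n k : ℕ) → 4 ≤ k → 3 * k + 1 ≤ n →
    (Σ (Digraph n) (λ A → IsOriented A × SFree k A ×
        ((n + k ∸ 1) * (n + k ∸ 1)) / 4 ≤ arcCount A))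
    ×
    ((A : Digraph n) → IsOriented A → SFree k A →
        arcCount A ≤ ((n + k ∸ 1) * (n + k ∸ 1)) / 4 + (k ∸ 1) * n)
theorem1p3 n zero    () _
theorem1p3 n (suc K) _  large rewrite +-suc n K =
  lowerBound n K large , λ A oriented free → UpperBound.arcCount≤ A K oriented free
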